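{- Let $n\ge12$ be an integer and let $2\le t\le n/3$ be an integer such that $m:=n/t$ is an integer. Let $G_t$ be the graph with vertex set $V_1\cup\dots\cup V_t$, where $V_i=\{u^i_1,\dots,u^i_m\}$, and edge set $E_1\cup\dots\cup E_t\cup E'$, where $E'=\{u^i_su^j_s:1\le s\le m,\ 1\le i<j\le t\}$ and $E_i=\{u^i_1u^i_2,\dots,u^i_{m-1}u^i_m,u^i_mu^i_1\}$ for $1\le i\le t$. Then for every $A\subseteq V(G_t)$ with $2\le|A|\le n/2$ we have $e_{G_t}(A,V(G_t)\setminus A)\ge t+2$.
   Context: $e_{G}(X,Y)$ denotes the number of edges of $G$ with one endpoint in $X$ and the other in $Y$. -}

module Defs where

open import Data.Nat using (ℕ; zero; suc; _+_; _≡ᵇ_)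
open import Data.Fin using (Fin; toℕ)
open import Data.Bool using (Bool; true; false; _∧_; _∨_; not; if_then_else_)
open import Data.Fin.Properties using () renaming (_≟_ to _≟F_)
open import Relation.Nullary.Decidable using (⌊_⌋)

ΣF : (k : ℕ) → (Fin k → ℕ) → ℕ
ΣF zero    f = 0
ΣF (suc k) f = f Fin.zero + ΣF k (λ i → f (Fin.suc i))

-- Vertex u^i_s of G_t is encoded as the pair (i , s) with i : Fin t, s : Fin m
-- (0-indexed).
cycle-step : (m : ℕ) → Fin m → Fin m → Bool
cycle-step m s s' =
  (toℕ s' ≡ᵇ suc (toℕ s)) ∨ ((suc (toℕ s) ≡ᵇ m) ∧ (toℕ s' ≡ᵇ 0))

adj : (t m : ℕ) → Fin t → Fin m → Fin t → Fin m → Bool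
adj t m i s j s' =
  (⌊ i ≟F j ⌋ ∧ (cycle-step m s s' ∨ cycle-step m s' s))
  ∨ (⌊ s ≟F s' ⌋ ∧ not ⌊ i ≟F j ⌋)

VSubset : ℕ → ℕ → Set
VSubset t m = Fin t → Fin m → Bool

card : (t m : ℕ) → VSubset t m → ℕ
card t m A = ΣF t (λ i → ΣF m (λ s → if A i s then 1 else 0))

-- e_{G_t}(A, V ∖ A): number of ordered pairs (x , y), x ∈ A, y ∉ A, xy ∈ E(G_t);
-- each edge across the cut is counted exactly once.
cut : (t m : ℕ) → VSubset t m → ℕ
cut t m A =
  ΣF t (λ i → ΣF m (λ s → ΣF t (λ j → ΣF m (λ s' →
    if A i s ∧ not (A j s') ∧ adj t m i s j s' then 1 else 0))))

-- A cut edge either joins consecutive vertices of one copy of C_m (a row u^i_·) or two vertices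
-- u^i_s, u^j_s of one column.  A row meeting both A and its complement contains at least two cut
-- edges, since a 2-colouring of a cycle changes colour at least twice, and a column with a vertices
-- in A contains a(t − a) ≥ t − 1 of them.  If every row is mixed this gives 2t ≥ t + 2.  Otherwise a
-- row is constant, of colour x say; if every column is mixed we get m(t − 1) ≥ t + 2.  Otherwise a
-- column is constant as well, hence of colour x, and each of the (at least two) vertices of colour
-- not x makes both its row and its column mixed: this gives 4 + (t − 1) or 2 + 2(t − 1) cut edges.
module Submission where

open import Defs
open import Data.Nat using (ℕ; zero; suc; _+_; _*_; _∸_; _≤_; z≤n; s≤s; s≤s⁻¹; NonZero; >-nonZero; _≤?_; _<?_)
open import Data.Nat.Properties
open import Data.Nat.DivMod using (_%_; _/_; _mod_; m≡m%n+[m/n]*n; [m+kn]%n≡m%n; [m+n]%n≡m%n; m<n⇒m%n≡m; n%n≡0; m%n<n)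
open import Data.Nat.Tactic.RingSolver using (solve-∀)
open import Data.Fin using (Fin; toℕ) renaming (zero to fzero; suc to fsuc)
open import Data.Fin.Properties using (any?; all?; ¬∀⟶∃¬; toℕ<n; toℕ-fromℕ<; toℕ-injective) renaming (_≟_ to _≟F_; suc-injective to fsuc-injective)
open import Data.Bool using (Bool; true; false; _∧_; _∨_; not; if_then_else_)
open import Data.Bool.Properties using (T-≡; T-∨; T-∧; ∨-zeroʳ; ∨-identityʳ; ∧-identityʳ; not-¬; ¬-not; not-injective) renaming (_≟_ to _≟B_)
open import Data.Product using (∃; ∃₂; _×_; _,_; proj₁; proj₂; uncurry)
open import Data.Sum using (_⊎_; inj₁; inj₂)
open import Data.Empty using (⊥)
open import Function.Bundles using (Equivalence)
open import Relation.Nullary using (¬_; Dec; yes; no; contradiction)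
open import Relation.Nullary.Decidable using (⌊_⌋; _×-dec_; from-yes; from-no)
open import Relation.Binary.PropositionalEquality using (_≡_; _≢_; refl; sym; trans; cong; cong₂; subst; module ≡-Reasoning)

[_] : Bool → ℕ
[ b ] = if b then 1 else 0

[b]≤1 : ∀ b → [ b ] ≤ 1
[b]≤1 true  = ≤-refl
[b]≤1 false = z≤n

1≤[b]⇒b≡true : ∀ {b} → 1 ≤ [ b ] → b ≡ true
1≤[b]⇒b≡true {true} _ = refl

[b]+[not-b]≡1 : ∀ b → [ b ] + [ not b ] ≡ 1
[b]+[not-b]≡1 true  = refl
[b]+[not-b]≡1 false = refl

ΣF-mono : ∀ k {f g : Fin k → ℕ} → (∀ i → f i ≤ g i) → ΣF k f ≤ ΣF k g
ΣF-mono zero    f≤g = z≤n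
ΣF-mono (suc k) f≤g = +-mono-≤ (f≤g fzero) (ΣF-mono k (λ i → f≤g (fsuc i)))

ΣF-cong : ∀ k {f g : Fin k → ℕ} → (∀ i → f i ≡ g i) → ΣF k f ≡ ΣF k g
ΣF-cong zero    f≗g = refl
ΣF-cong (suc k) f≗g = cong₂ _+_ (f≗g fzero) (ΣF-cong k (λ i → f≗g (fsuc i)))

ΣF-const : ∀ k c → ΣF k (λ _ → c) ≡ k * c
ΣF-const zero    c = refl
ΣF-const (suc k) c = cong (c +_) (ΣF-const k c)

ΣF-+ : ∀ k (f g : Fin k → ℕ) → ΣF k (λ i → f i + g i) ≡ ΣF k f + ΣF k g
ΣF-+ zero    f g = refl
ΣF-+ (suc k) f g = trans (cong (f fzero + g fzero +_) (ΣF-+ k (λ i → f (fsuc i)) (λ i → g (fsuc i))))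
                         (interchange (f fzero) (g fzero) _ _)
  where
  interchange : ∀ a b c d → (a + b) + (c + d) ≡ (a + c) + (b + d)
  interchange = solve-∀

ΣF-+-≤ : ∀ k {f g h : Fin k → ℕ} → (∀ i → f i + g i ≤ h i) → ΣF k f + ΣF k g ≤ ΣF k h
ΣF-+-≤ k {f} {g} f+g≤h = ≤-trans (≤-reflexive (sym (ΣF-+ k f g))) (ΣF-mono k f+g≤h)

ΣF-*ʳ : ∀ k (f : Fin k → ℕ) c → ΣF k (λ i → f i * c) ≡ ΣF k f * c
ΣF-*ʳ zero    f c = refl
ΣF-*ʳ (suc k) f c = trans (cong (f fzero * c +_) (ΣF-*ʳ k (λ i → f (fsuc i)) c))
                          (sym (*-distribʳ-+ c (f fzero) _))

ΣF-comm : ∀ k l (f : Fin k → Fin l → ℕ) →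
          ΣF k (λ i → ΣF l (f i)) ≡ ΣF l (λ j → ΣF k (λ i → f i j))
ΣF-comm zero    l f = sym (trans (ΣF-const l 0) (*-zeroʳ l))
ΣF-comm (suc k) l f = trans (cong (ΣF l (f fzero) +_) (ΣF-comm k l (λ i → f (fsuc i))))
                            (sym (ΣF-+ l (f fzero) _))

ΣF-lower-bound : ∀ k {f : Fin k → ℕ} c → (∀ i → c ≤ f i) → k * c ≤ ΣF k f
ΣF-lower-bound k c c≤f = subst (_≤ ΣF k _) (ΣF-const k c) (ΣF-mono k c≤f)

ΣF-single : ∀ k (f : Fin k → ℕ) i → f i ≤ ΣF k f
ΣF-single (suc k) f fzero    = m≤m+n _ _
ΣF-single (suc k) f (fsuc i) = ≤-trans (ΣF-single k (λ j → f (fsuc j)) i) (m≤n+m _ _)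

ΣF-pair : ∀ k (f : Fin k → ℕ) {i j} → i ≢ j → f i + f j ≤ ΣF k f
ΣF-pair (suc k) f {fzero}  {fzero}  i≢j = contradiction refl i≢j
ΣF-pair (suc k) f {fzero}  {fsuc j} i≢j = +-monoʳ-≤ (f fzero) (ΣF-single k _ j)
ΣF-pair (suc k) f {fsuc i} {fzero}  i≢j =
  subst (_≤ ΣF (suc k) f) (+-comm (f fzero) (f (fsuc i))) (+-monoʳ-≤ (f fzero) (ΣF-single k _ i))
ΣF-pair (suc k) f {fsuc i} {fsuc j} i≢j =
  ≤-trans (ΣF-pair k (λ x → f (fsuc x)) (λ i≡j → i≢j (cong fsuc i≡j))) (m≤n+m _ _)

ΣF²-pair : ∀ k l (f : Fin k → Fin l → ℕ) {p q : Fin k × Fin l} → p ≢ q →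
           1 ≤ uncurry f p → 1 ≤ uncurry f q → 2 ≤ ΣF k (λ i → ΣF l (f i))
ΣF²-pair k l f {i , a} {j , b} p≢q 1≤fp 1≤fq with i ≟F j
... | no i≢j =
  ≤-trans (+-mono-≤ (≤-trans 1≤fp (ΣF-single l (f i) a)) (≤-trans 1≤fq (ΣF-single l (f j) b)))
          (ΣF-pair k (λ u → ΣF l (f u)) i≢j)
... | yes refl =
  ≤-trans (≤-trans (+-mono-≤ 1≤fp 1≤fq) (ΣF-pair l (f i) (λ a≡b → p≢q (cong (i ,_) a≡b))))
          (ΣF-single k (λ u → ΣF l (f u)) i)

ΣF-positive : ∀ k (f : Fin k → ℕ) → 1 ≤ ΣF k f → ∃ λ i → 1 ≤ f i
ΣF-positive (suc k) f 1≤Σ with f fzero in f0≡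
... | suc _ = fzero , subst (1 ≤_) (sym f0≡) (s≤s z≤n)
... | zero with ΣF-positive k (λ i → f (fsuc i)) 1≤Σ
...   | i , 1≤fi = fsuc i , 1≤fi

ΣF-two-positive : ∀ k (f : Fin k → ℕ) → 2 ≤ ΣF k f →
                  (∃ λ i → 2 ≤ f i) ⊎ (∃₂ λ i j → i ≢ j × 1 ≤ f i × 1 ≤ f j)
ΣF-two-positive (suc k) f 2≤Σ with f fzero in f0≡
... | suc (suc _) = inj₁ (fzero , subst (2 ≤_) (sym f0≡) (s≤s (s≤s z≤n)))
... | suc zero with ΣF-positive k (λ i → f (fsuc i)) (s≤s⁻¹ 2≤Σ)
...   | j , 1≤fj = inj₂ (fzero , fsuc j , (λ ()) , subst (1 ≤_) (sym f0≡) ≤-refl , 1≤fj)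
ΣF-two-positive (suc k) f 2≤Σ | zero with ΣF-two-positive k (λ i → f (fsuc i)) 2≤Σ
... | inj₁ (i , 2≤fi)                 = inj₁ (fsuc i , 2≤fi)
... | inj₂ (i , j , i≢j , 1≤fi , 1≤fj) = inj₂ (fsuc i , fsuc j , (λ e → i≢j (fsuc-injective e)) , 1≤fi , 1≤fj)

count : ∀ k → (Fin k → Bool) → ℕ
count k g = ΣF k (λ i → [ g i ])

count-positive : ∀ {k} {g : Fin k → Bool} {a} → g a ≡ true → 1 ≤ count k g
count-positive {k} {g} {a} ga = ≤-trans (≤-reflexive (cong [_] (sym ga))) (ΣF-single k _ a)

count-complement : ∀ k (g : Fin k → Bool) → count k g + count k (λ i → not (g i)) ≡ k
count-complement k g = begin
  count k g + count k (λ i → not (g i))  ≡⟨ ΣF-+ k _ _ ⟨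
  ΣF k (λ i → [ g i ] + [ not (g i) ])   ≡⟨ ΣF-cong k (λ i → [b]+[not-b]≡1 (g i)) ⟩
  ΣF k (λ _ → 1)                         ≡⟨ ΣF-const k 1 ⟩
  k * 1                                  ≡⟨ *-identityʳ k ⟩
  k                                      ∎
  where open ≡-Reasoning

card-complement : ∀ t m (A : VSubset t m) → card t m A + card t m (λ i s → not (A i s)) ≡ t * m
card-complement t m A =
  trans (sym (ΣF-+ t _ _)) (trans (ΣF-cong t (λ i → count-complement m (A i))) (ΣF-const t m))

Constant : ∀ {k} → (Fin k → Bool) → Set
Constant g = ∀ a b → g a ≡ g b

Mixed : ∀ {k} → (Fin k → Bool) → Set
Mixed g = (∃ λ a → g a ≡ true) × (∃ λ b → g b ≡ false)

mixed : ∀ {k} {g : Fin k → Bool} {a b} x → g a ≡ x → g b ≡ not x → Mixed g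
mixed true  ga gb = (_ , ga) , (_ , gb)
mixed false ga gb = (_ , gb) , (_ , ga)

mixed? : ∀ {k} (g : Fin k → Bool) → Dec (Mixed g)
mixed? g = any? (λ a → g a ≟B true) ×-dec any? (λ b → g b ≟B false)

¬mixed⇒constant : ∀ {k} {g : Fin k → Bool} → ¬ Mixed g → Constant g
¬mixed⇒constant {g = g} ¬mix a b with g a in ga | g b in gb
... | true  | true  = refl
... | false | false = refl
... | true  | false = contradiction ((a , ga) , (b , gb)) ¬mix
... | false | true  = contradiction ((b , gb) , (a , ga)) ¬mix

all-mixed-or-constant : ∀ {n k} (F : Fin n → Fin k → Bool) →
                        (∀ i → Mixed (F i)) ⊎ (∃ λ i → Constant (F i))
all-mixed-or-constant {n} F with all? (λ i → mixed? (F i))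
... | yes all-mixed = inj₁ all-mixed
... | no ¬all-mixed with ¬∀⟶∃¬ n _ (λ i → mixed? (F i)) ¬all-mixed
...   | i , ¬mix = inj₂ (i , ¬mixed⇒constant ¬mix)

TwoCells : ∀ {t m} → (Fin t → Fin m → Bool) → Bool → Set
TwoCells {t} {m} A y = ∃₂ λ (p q : Fin t × Fin m) → p ≢ q × uncurry A p ≡ y × uncurry A q ≡ y

card≥2⇒two-cells : ∀ {t m} (A : VSubset t m) → 2 ≤ card t m A → TwoCells A true
card≥2⇒two-cells {t} {m} A 2≤card with ΣF-two-positive t (λ i → count m (A i)) 2≤card
... | inj₁ (i , 2≤row) with ΣF-two-positive m (λ s → [ A i s ]) 2≤row
...   | inj₁ (s , 2≤[Ais]) = contradiction (≤-trans 2≤[Ais] ([b]≤1 (A i s))) 1+n≰n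
...   | inj₂ (s , s' , s≢s' , 1≤[Ais] , 1≤[Ais']) =
  (i , s) , (i , s') , (λ e → s≢s' (cong proj₂ e)) , 1≤[b]⇒b≡true 1≤[Ais] , 1≤[b]⇒b≡true 1≤[Ais']
card≥2⇒two-cells {t} {m} A 2≤card | inj₂ (i , j , i≢j , 1≤row-i , 1≤row-j)
  with ΣF-positive m _ 1≤row-i | ΣF-positive m _ 1≤row-j
... | s , 1≤[Ais] | s' , 1≤[Ajs'] =
  (i , s) , (j , s') , (λ e → i≢j (cong proj₁ e)) , 1≤[b]⇒b≡true 1≤[Ais] , 1≤[b]⇒b≡true 1≤[Ajs']

-- r and c stand for the numbers of cut edges inside the rows and inside the columns.
module _ {t m} (A : Fin t → Fin m → Bool) (r : Fin t → ℕ) (c : Fin m → ℕ)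
         (r-mixed : ∀ i → Mixed (A i) → 2 ≤ r i)
         (c-mixed : ∀ s → Mixed (λ i → A i s) → t ≤ c s + 1)
         (2≤t : 2 ≤ t)
  where

  all-rows-mixed-bound : (∀ i → Mixed (A i)) → t + 2 ≤ ΣF t r + ΣF m c
  all-rows-mixed-bound rows = begin
    t + 2        ≤⟨ +-monoʳ-≤ t 2≤t ⟩
    t + t        ≡⟨ t+t≡t*2 t ⟩
    t * 2        ≤⟨ ΣF-lower-bound t 2 (λ i → r-mixed i (rows i)) ⟩
    ΣF t r       ≤⟨ m≤m+n _ _ ⟩
    ΣF t r + ΣF m c ∎
    where
    open ≤-Reasoning
    t+t≡t*2 : ∀ t → t + t ≡ t * 2
    t+t≡t*2 = solve-∀

  all-columns-mixed-bound : 3 ≤ m → 12 ≤ t * m → (∀ s → Mixed (λ i → A i s)) → t + 2 ≤ ΣF t r + ΣF m c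
  all-columns-mixed-bound 3≤m 12≤tm cols = ≤-trans (+-cancelˡ-≤ m _ _ m+[t+2]≤m+Σc) (m≤n+m _ _)
    where
    open ≤-Reasoning
    -- m (t - 1) ≥ t + 2 fails only for t = 2, m = 3, which 12 ≤ t m excludes
    m+[t+2]≤m*t : ∀ t m → 2 ≤ t → 3 ≤ m → 12 ≤ t * m → m + (t + 2) ≤ m * t
    m+[t+2]≤m*t zero             _ () _ _
    m+[t+2]≤m*t (suc zero)       _ (s≤s ()) _ _
    m+[t+2]≤m*t (suc (suc _)) zero                _ () _
    m+[t+2]≤m*t (suc (suc _)) (suc zero)          _ (s≤s ()) _
    m+[t+2]≤m*t (suc (suc _)) (suc (suc zero))    _ (s≤s (s≤s ())) _
    m+[t+2]≤m*t (suc (suc zero)) (suc (suc (suc zero))) _ _ 12≤6 = contradiction 12≤6 (from-no (12 ≤? 6))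
    m+[t+2]≤m*t (suc (suc zero)) (suc (suc (suc (suc b)))) _ _ _ =
      ≤-trans (m≤m+n _ b) (≤-reflexive (identity b))
      where
      identity : ∀ b → (4 + b + 4) + b ≡ (4 + b) * 2
      identity = solve-∀
    m+[t+2]≤m*t (suc (suc (suc a))) (suc (suc (suc b))) _ _ _ =
      ≤-trans (m≤m+n _ (1 + 2 * a + 2 * b + b * a)) (≤-reflexive (identity a b))
      where
      identity : ∀ a b → (3 + b + (3 + a + 2)) + (1 + 2 * a + 2 * b + b * a) ≡ (3 + b) * (3 + a)
      identity = solve-∀
    m+[t+2]≤m+Σc : m + (t + 2) ≤ m + ΣF m c
    m+[t+2]≤m+Σc = begin
      m + (t + 2)                  ≤⟨ m+[t+2]≤m*t t m 2≤t 3≤m 12≤tm ⟩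
      m * t                        ≤⟨ ΣF-lower-bound m t (λ s → c-mixed s (cols s)) ⟩
      ΣF m (λ s → c s + 1)         ≡⟨ ΣF-+ m c (λ _ → 1) ⟩
      ΣF m c + ΣF m (λ _ → 1)      ≡⟨ cong (ΣF m c +_) (trans (ΣF-const m 1) (*-identityʳ m)) ⟩
      ΣF m c + m                   ≡⟨ +-comm (ΣF m c) m ⟩
      m + ΣF m c                   ∎

  constant-row-and-column-bound : ∀ i₀ s₁ → Constant (A i₀) → Constant (λ i → A i s₁) →
                                  TwoCells A (not (A i₀ s₁)) → t + 2 ≤ ΣF t r + ΣF m c
  constant-row-and-column-bound i₀ s₁ row₀ col₁ ((j , s₂) , (j' , s₂') , p≢q , e , e') with j ≟F j'
  ... | yes refl =
    two-columns (c-mixed s₂ (mixed _ (row₀ s₂ s₁) e)) (c-mixed s₂' (mixed _ (row₀ s₂' s₁) e'))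
                (≤-trans (r-mixed j (mixed _ (col₁ j i₀) e)) (ΣF-single t r j))
                (ΣF-pair m c (λ s₂≡s₂' → p≢q (cong (j ,_) s₂≡s₂')))
    where
    open ≤-Reasoning
    two-columns : ∀ {a b R C} → t ≤ a + 1 → t ≤ b + 1 → 2 ≤ R → a + b ≤ C → t + 2 ≤ R + C
    two-columns {a} {b} {R} {C} t≤a+1 t≤b+1 2≤R a+b≤C = begin
      t + 2            ≤⟨ +-monoʳ-≤ t 2≤t ⟩
      t + t            ≤⟨ +-mono-≤ t≤a+1 t≤b+1 ⟩
      (a + 1) + (b + 1) ≡⟨ identity a b ⟩
      2 + (a + b)      ≤⟨ +-mono-≤ 2≤R a+b≤C ⟩
      R + C            ∎
      where
      identity : ∀ a b → (a + 1) + (b + 1) ≡ 2 + (a + b)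
      identity = solve-∀
  ... | no j≢j' =
    one-column (c-mixed s₂ (mixed _ (row₀ s₂ s₁) e))
               (≤-trans (+-mono-≤ (r-mixed j (mixed _ (col₁ j i₀) e)) (r-mixed j' (mixed _ (col₁ j' i₀) e')))
                        (ΣF-pair t r j≢j'))
               (ΣF-single m c s₂)
    where
    open ≤-Reasoning
    one-column : ∀ {a R C} → t ≤ a + 1 → 4 ≤ R → a ≤ C → t + 2 ≤ R + C
    one-column {a} {R} {C} t≤a+1 4≤R a≤C = begin
      t + 2        ≤⟨ +-monoˡ-≤ 2 t≤a+1 ⟩
      a + 1 + 2    ≡⟨ +-comm (a + 1) 2 ⟩
      2 + (a + 1)  ≡⟨ cong (2 +_) (+-comm a 1) ⟩
      3 + a        ≤⟨ +-mono-≤ (≤-trans (n≤1+n 3) 4≤R) a≤C ⟩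
      R + C        ∎

  mixed-lines-bound : 3 ≤ m → 12 ≤ t * m → (∀ y → TwoCells A y) → t + 2 ≤ ΣF t r + ΣF m c
  mixed-lines-bound 3≤m 12≤tm cells with all-mixed-or-constant A
  ... | inj₁ rows = all-rows-mixed-bound rows
  ... | inj₂ (i₀ , row₀) with all-mixed-or-constant (λ s i → A i s)
  ...   | inj₁ cols        = all-columns-mixed-bound 3≤m 12≤tm cols
  ...   | inj₂ (s₁ , col₁) = constant-row-and-column-bound i₀ s₁ row₀ col₁ (cells (not (A i₀ s₁)))

CyclicSucc : ∀ m → Fin m → Fin m → Set
CyclicSucc m s s' = toℕ s' ≡ suc (toℕ s) ⊎ (suc (toℕ s) ≡ m × toℕ s' ≡ 0)

cycle-step-complete : ∀ {m} {s s' : Fin m} → CyclicSucc m s s' → cycle-step m s s' ≡ true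
cycle-step-complete (inj₁ s'≡1+s) =
  Equivalence.to T-≡ (Equivalence.from T-∨ (inj₁ (≡⇒≡ᵇ _ _ s'≡1+s)))
cycle-step-complete (inj₂ (1+s≡m , s'≡0)) =
  Equivalence.to T-≡ (Equivalence.from T-∨ (inj₂ (Equivalence.from T-∧ (≡⇒≡ᵇ _ _ 1+s≡m , ≡⇒≡ᵇ _ _ s'≡0))))

CyclicSucc-asym : ∀ {m} {s s' : Fin m} → 3 ≤ m → CyclicSucc m s s' → CyclicSucc m s' s → ⊥
CyclicSucc-asym 3≤m (inj₁ s'≡1+s) (inj₁ s≡1+s') =
  <-asym (≤-reflexive (sym s'≡1+s)) (≤-reflexive (sym s≡1+s'))
CyclicSucc-asym 3≤m (inj₁ s'≡1+s) (inj₂ (1+s'≡m , s≡0)) =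
  <⇒≱ 3≤m (≤-reflexive (trans (sym 1+s'≡m) (cong suc (trans s'≡1+s (cong suc s≡0)))))
CyclicSucc-asym 3≤m (inj₂ (1+s≡m , s'≡0)) (inj₁ s≡1+s') =
  <⇒≱ 3≤m (≤-reflexive (trans (sym 1+s≡m) (cong suc (trans s≡1+s' (cong suc s'≡0)))))
CyclicSucc-asym 3≤m (inj₂ (1+s≡m , s'≡0)) (inj₂ (1+s'≡m , s≡0)) =
  <⇒≱ 3≤m (m≤n⇒m≤1+n (≤-reflexive (trans (sym 1+s'≡m) (cong suc s'≡0))))

module _ {m} .{{_ : NonZero m}} where

  toℕ-mod : ∀ k → toℕ (k mod m) ≡ k % m
  toℕ-mod k = toℕ-fromℕ< (m%n<n k m)

  toℕ-mod-inverse : (a : Fin m) → toℕ a mod m ≡ a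
  toℕ-mod-inverse a = toℕ-injective (trans (toℕ-mod (toℕ a)) (m<n⇒m%n≡m (toℕ<n a)))

  mod-periodic : ∀ k → (k + m) mod m ≡ k mod m
  mod-periodic k = toℕ-injective (trans (toℕ-mod (k + m)) (trans ([m+n]%n≡m%n k m) (sym (toℕ-mod k))))

  [1+k]%m≡[1+k%m]%m : ∀ k → suc k % m ≡ suc (k % m) % m
  [1+k]%m≡[1+k%m]%m k =
    trans (cong (λ n → suc n % m) (m≡m%n+[m/n]*n k m)) ([m+kn]%n≡m%n (suc (k % m)) (k / m) m)

  [1+k]%m : ∀ k → suc k % m ≡ suc (k % m) ⊎ (suc (k % m) ≡ m × suc k % m ≡ 0)
  [1+k]%m k with suc (k % m) <? m
  ... | yes 1+k%m<m = inj₁ (trans ([1+k]%m≡[1+k%m]%m k) (m<n⇒m%n≡m 1+k%m<m))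
  ... | no  1+k%m≮m = inj₂ (1+k%m≡m , trans ([1+k]%m≡[1+k%m]%m k) (trans (cong (_% m) 1+k%m≡m) (n%n≡0 m)))
    where
    1+k%m≡m : suc (k % m) ≡ m
    1+k%m≡m = ≤-antisym (m%n<n k m) (≮⇒≥ 1+k%m≮m)

  CyclicSucc-mod : ∀ k → CyclicSucc m (k mod m) (suc k mod m)
  CyclicSucc-mod k rewrite toℕ-mod k | toℕ-mod (suc k) = [1+k]%m k

crossing : (H : ℕ → Bool) {x : Bool} → ∀ a d → H a ≡ x → H (d + a) ≡ not x →
           ∃ λ k → H k ≡ x × H (suc k) ≡ not x
crossing H {x} a zero    Ha≡x Ha≡¬x = contradiction (trans (sym Ha≡x) Ha≡¬x) (not-¬ refl)
crossing H {x} a (suc d) Ha≡x Hb≡¬x with H (d + a) ≟B x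
... | yes Hk≡x = d + a , Hk≡x , Hb≡¬x
... | no  Hk≢x = crossing H a d Ha≡x (¬-not Hk≢x)

cycle-crossing : ∀ {m} .{{_ : NonZero m}} (g : Fin m → Bool) {a b : Fin m} x →
                 g a ≡ x → g b ≡ not x → ∃₂ λ s s' → CyclicSucc m s s' × g s ≡ x × g s' ≡ not x
-- Read g along ℕ through k mod m, from toℕ a up to toℕ b + m.
cycle-crossing {m} g {a} {b} x ga≡x gb≡¬x =
  reduce (crossing (λ k → g (k mod m)) (toℕ a) (toℕ b + m ∸ toℕ a) start end)
  where
  open ≡-Reasoning
  start : g (toℕ a mod m) ≡ x
  start = trans (cong g (toℕ-mod-inverse a)) ga≡x
  end : g ((toℕ b + m ∸ toℕ a + toℕ a) mod m) ≡ not x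
  end = begin
    g ((toℕ b + m ∸ toℕ a + toℕ a) mod m) ≡⟨ cong (λ k → g (k mod m)) (m∸n+n≡m a≤b+m) ⟩
    g ((toℕ b + m) mod m)                 ≡⟨ cong g (trans (mod-periodic (toℕ b)) (toℕ-mod-inverse b)) ⟩
    g b                                   ≡⟨ gb≡¬x ⟩
    not x                                 ∎
    where
    a≤b+m : toℕ a ≤ toℕ b + m
    a≤b+m = ≤-trans (<⇒≤ (toℕ<n a)) (m≤n+m m (toℕ b))
  reduce : (∃ λ k → g (k mod m) ≡ x × g (suc k mod m) ≡ not x) →
           ∃₂ λ s s' → CyclicSucc m s s' × g s ≡ x × g s' ≡ not x
  reduce (k , gk≡x , g[1+k]≡¬x) = k mod m , suc k mod m , CyclicSucc-mod k , gk≡x , g[1+k]≡¬x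

cyclic : ∀ m → Fin m → Fin m → Bool
cyclic m s s' = cycle-step m s s' ∨ cycle-step m s' s

boundary : ∀ m → (Fin m → Bool) → ℕ
boundary m g = ΣF m (λ s → ΣF m (λ s' → [ g s ∧ not (g s') ∧ cyclic m s s' ]))

boundary-mixed : ∀ {m} (g : Fin m → Bool) → 3 ≤ m → Mixed g → 2 ≤ boundary m g
boundary-mixed {suc m} g 3≤m ((a , ga≡true) , (b , gb≡false))
  with cycle-crossing g true ga≡true gb≡false | cycle-crossing g false gb≡false ga≡true
... | s , s' , s↦s' , gs , gs' | u , u' , u↦u' , gu , gu' =
  ΣF²-pair (suc m) (suc m) (λ v v' → [ g v ∧ not (g v') ∧ cyclic (suc m) v v' ]) {s , s'} {u' , u}
    (λ { refl → CyclicSucc-asym 3≤m s↦s' u↦u' })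
    (counted gs gs' (cong (_∨ cycle-step (suc m) s' s) (cycle-step-complete s↦s')))
    (counted gu' gu (trans (cong (cycle-step (suc m) u' u ∨_) (cycle-step-complete u↦u')) (∨-zeroʳ _)))
  where
  counted : ∀ {v v'} → g v ≡ true → g v' ≡ false → cyclic (suc m) v v' ≡ true →
            1 ≤ [ g v ∧ not (g v') ∧ cyclic (suc m) v v' ]
  counted gv gv' vv' rewrite gv | gv' | vv' = ≤-refl

cross : ∀ k → (Fin k → Bool) → ℕ
cross k g = ΣF k (λ i → ΣF k (λ j → [ g i ∧ not (g j) ]))

cross≡count*count : ∀ k (g : Fin k → Bool) → cross k g ≡ count k g * count k (λ j → not (g j))
cross≡count*count k g =
  trans (ΣF-cong k (λ i → ΣF-[∧] (g i))) (ΣF-*ʳ k (λ i → [ g i ]) (count k (λ j → not (g j))))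
  where
  ΣF-[∧] : ∀ b → ΣF k (λ j → [ b ∧ not (g j) ]) ≡ [ b ] * count k (λ j → not (g j))
  ΣF-[∧] true  = sym (+-identityʳ _)
  ΣF-[∧] false = trans (ΣF-const k 0) (*-zeroʳ k)

cross-mixed : ∀ {k} (g : Fin k → Bool) → Mixed g → k ≤ cross k g + 1
cross-mixed {k} g ((a , ga≡true) , (b , gb≡false)) = begin
  k                         ≡⟨ count-complement k g ⟨
  count k g + count k ¬g    ≤⟨ +≤*+1 (count-positive {g = g} ga≡true) (count-positive {g = ¬g} (cong not gb≡false)) ⟩
  count k g * count k ¬g + 1 ≡⟨ cong (_+ 1) (cross≡count*count k g) ⟨
  cross k g + 1             ∎
  where
  open ≤-Reasoning
  ¬g : Fin k → Bool
  ¬g j = not (g j)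
  +≤*+1 : ∀ {p q} → 1 ≤ p → 1 ≤ q → p + q ≤ p * q + 1
  +≤*+1 {suc p} {suc q} _ _ = ≤-trans (m≤m+n _ (p * q)) (≤-reflexive (identity p q))
    where
    identity : ∀ p q → (suc p + suc q) + p * q ≡ suc p * suc q + 1
    identity = solve-∀

module _ {t m} (A : VSubset t m) where

  private
    edge cyclePart matchPart : Fin t → Fin m → Fin t → Fin m → ℕ
    edge i s j s' = [ A i s ∧ not (A j s') ∧ adj t m i s j s' ]
    cyclePart i s j s' = if ⌊ i ≟F j ⌋ then [ A i s ∧ not (A j s') ∧ cyclic m s s' ] else 0
    matchPart i s j s' = if ⌊ s ≟F s' ⌋ then [ A i s ∧ not (A j s') ] else 0

    -- The two parts overlap only at j = i, s' = s, where no edge leaves A.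
    parts≤edge : ∀ i s j s' → cyclePart i s j s' + matchPart i s j s' ≤ edge i s j s'
    parts≤edge i s j s' with i ≟F j | s ≟F s'
    ... | yes refl | yes refl = ≤-trans (≤-reflexive (vanish (A i s) (cyclic m s s))) z≤n
      where
      vanish : ∀ b c → [ b ∧ not b ∧ c ] + [ b ∧ not b ] ≡ 0
      vanish true  c = refl
      vanish false c = refl
    ... | yes refl | no _ rewrite +-identityʳ [ A i s ∧ not (A i s') ∧ cyclic m s s' ]
                                | ∨-identityʳ (cyclic m s s') = ≤-refl
    ... | no _ | yes refl rewrite ∧-identityʳ (not (A j s)) = ≤-refl
    ... | no _ | no _ = z≤n

    cycle≤cyclePart : ∀ i s s' → [ A i s ∧ not (A i s') ∧ cyclic m s s' ] ≤ cyclePart i s i s'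
    cycle≤cyclePart i s s' with i ≟F i
    ... | yes _  = ≤-refl
    ... | no i≢i = contradiction refl i≢i

    match≤matchPart : ∀ i s j → [ A i s ∧ not (A j s) ] ≤ matchPart i s j s
    match≤matchPart i s j with s ≟F s
    ... | yes _  = ≤-refl
    ... | no s≢s = contradiction refl s≢s

    edges-at : ∀ i s → ΣF m (λ s' → [ A i s ∧ not (A i s') ∧ cyclic m s s' ])
                     + ΣF t (λ j → [ A i s ∧ not (A j s) ])
                     ≤ ΣF t (λ j → ΣF m (edge i s j))
    edges-at i s = ≤-trans
      (+-mono-≤ (≤-trans (ΣF-mono m (cycle≤cyclePart i s)) (ΣF-single t (λ j → ΣF m (cyclePart i s j)) i))
                (ΣF-mono t (λ j → ≤-trans (match≤matchPart i s j) (ΣF-single m (matchPart i s j) s))))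
      (ΣF-+-≤ t (λ j → ΣF-+-≤ m (parts≤edge i s j)))

  cut-lower-bound : ΣF t (λ i → boundary m (A i)) + ΣF m (λ s → cross t (λ i → A i s)) ≤ cut t m A
  cut-lower-bound = begin
    ΣF t (λ i → boundary m (A i)) + ΣF m (λ s → cross t (λ i → A i s))
      ≡⟨ cong (ΣF t (λ i → boundary m (A i)) +_) (ΣF-comm t m matches) ⟨
    ΣF t (λ i → boundary m (A i)) + ΣF t (λ i → ΣF m (matches i))
      ≤⟨ ΣF-+-≤ t (λ i → ΣF-+-≤ m (edges-at i)) ⟩
    cut t m A ∎
    where
    open ≤-Reasoning
    matches : Fin t → Fin m → ℕ
    matches i s = ΣF t (λ j → [ A i s ∧ not (A j s) ])

complement-two-cells : ∀ {t m} (A : VSubset t m) → TwoCells (λ i s → not (A i s)) true → TwoCells A false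
complement-two-cells A (p , q , p≢q , e , e') = p , q , p≢q , not-injective e , not-injective e'

minority-complement : ∀ {a b n} → a + b ≡ n → 2 * a ≤ n → 4 ≤ n → 2 ≤ b
minority-complement {a} {b} {n} a+b≡n 2a≤n 4≤n = *-cancelˡ-≤ 2 (begin
  2 * 2   ≤⟨ 4≤n ⟩
  n       ≡⟨ a+b≡n ⟨
  a + b   ≤⟨ +-monoˡ-≤ b a≤b ⟩
  b + b   ≡⟨ cong (b +_) (+-identityʳ b) ⟨
  2 * b   ∎)
  where
  open ≤-Reasoning
  a≤b : a ≤ b
  a≤b = +-cancelˡ-≤ a a b (begin
    a + a   ≡⟨ cong (a +_) (+-identityʳ a) ⟨
    2 * a   ≤⟨ 2a≤n ⟩
    n       ≡⟨ a+b≡n ⟨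
    a + b   ∎)

claim9p3 : (n t m : ℕ) → 12 ≤ n → 2 ≤ t → 3 * t ≤ n → n ≡ t * m →
           (A : VSubset t m) → 2 ≤ card t m A → 2 * card t m A ≤ n →
           t + 2 ≤ cut t m A
claim9p3 n t m 12≤n 2≤t 3t≤n refl A 2≤|A| 2|A|≤n =
  ≤-trans (mixed-lines-bound A (λ i → boundary m (A i)) (λ s → cross t (λ i → A i s))
                             (λ i → boundary-mixed (A i) 3≤m) (λ s → cross-mixed (λ i → A i s))
                             2≤t 3≤m 12≤n two-cells)
          (cut-lower-bound A)
  where
  3≤m : 3 ≤ m
  3≤m = *-cancelˡ-≤ t {{>-nonZero (≤-trans (s≤s z≤n) 2≤t)}} (subst (_≤ t * m) (*-comm 3 t) 3t≤n)
  two-cells : ∀ y → TwoCells A y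
  two-cells true  = card≥2⇒two-cells A 2≤|A|
  two-cells false = complement-two-cells A (card≥2⇒two-cells (λ i s → not (A i s))
    (minority-complement (card-complement t m A) 2|A|≤n (≤-trans (from-yes (4 ≤? 12)) 12≤n)))
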